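{- Let $x,y$ be nonzero complex numbers and let $(a_{n,0})_{n\geq 0}$ be a sequence of complex numbers. Define an infinite matrix $(a_{n,m})_{n,m\geq 0}$ whose first column is the given sequence and whose remaining entries are determined by $$a_{n,m+1}=\frac{1}{x(m+1)}\left(a_{n+1,m}-y\,m\,a_{n,m}\right)\qquad(n,m\geq 0).$$ Then: (1) For all $n,m\geq 0$, $$a_{n,m}=\frac{y^{m}}{x^{m}m!}\sum_{k=0}^{m}y^{ -k}s(m,k)\,a_{n+k,0}.$$ (2) For $s\geq 0$ let $\widehat{B}_s(t)=\sum_{k\geq 0}a_{k+s,0}\frac{t^{k}}{k!}$ and $\widehat{A}_s(t)=\sum_{m\geq 0}a_{s,m}t^{m}$ (formal power series). Then, as formal power series in $t$, $$\widehat{A}_s(t)=\widehat{B}_s\!\left(y^{ -1}\ln\!\left(1+\frac{ty}{x}\right)\right).$$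
   Context: The signed Stirling numbers of the first kind $s(n,k)$ are defined by $x(x-1)\cdots(x-n+1)=\sum_{k=0}^{n}s(n,k)x^{k}$, with $s(n,k)=0$ for $k>n$ or $k<0$. Here $\ln(1+u)=\sum_{j\geq1}(-1)^{j-1}u^j/j$ as a formal power series, so the composition is well defined. -}

module Defs where

open import Level using (Level; _⊔_) renaming (suc to lsuc)
open import Algebra.Bundles using (CommutativeRing)
open import Data.Nat using (ℕ; zero; suc)
import Data.Nat as ℕ
open import Data.Nat.Combinatorics using ()
open import Data.Nat.Base using (_!)
open import Data.Integer as ℤ using (ℤ; +_; -[1+_])
open import Relation.Binary.PropositionalEquality using (_≡_)

-- Signed Stirling numbers of the first kind, defined via the falling
-- factorial  x(x-1)...(x-n+1) = Σ_k s(n,k) x^k .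
-- A polynomial with integer coefficients is represented by its
-- coefficient sequence ℕ → ℤ (index k = coefficient of x^k).

mulXminus : ℕ → (ℕ → ℤ) → (ℕ → ℤ)
mulXminus c p zero    = ℤ.- ((+ c) ℤ.* p zero)
mulXminus c p (suc k) = p k ℤ.- ((+ c) ℤ.* p (suc k))

fallingFactorialCoeffs : ℕ → (ℕ → ℤ)
fallingFactorialCoeffs zero zero    = + 1
fallingFactorialCoeffs zero (suc k) = + 0
fallingFactorialCoeffs (suc n) = mulXminus n (fallingFactorialCoeffs n)

stirling1 : ℕ → ℕ → ℤ
stirling1 n k = fallingFactorialCoeffs n k

-- A field of characteristic zero (ℂ is one).  The inverse is a total
-- function, constrained only on nonzero elements.

natToRing : ∀ {c ℓ} (R : CommutativeRing c ℓ) → ℕ → CommutativeRing.Carrier R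
natToRing R zero    = CommutativeRing.0# R
natToRing R (suc n) = CommutativeRing._+_ R (CommutativeRing.1# R) (natToRing R n)

record CharZeroField (c ℓ : Level) : Set (lsuc (c ⊔ ℓ)) where
  field
    commutativeRing : CommutativeRing c ℓ
  open CommutativeRing commutativeRing public
  field
    _⁻¹      : Carrier → Carrier
    ⁻¹-cong  : ∀ {u v} → u ≈ v → u ⁻¹ ≈ v ⁻¹
    inverseʳ : ∀ u → u ≉ 0# → u * (u ⁻¹) ≈ 1#

    charZero : ∀ n → natToRing commutativeRing n ≈ 0# → n ≡ 0

  ι : ℕ → Carrier
  ι = natToRing commutativeRing

module FieldDefs {c ℓ : Level} (F : CharZeroField c ℓ) where
  open CharZeroField F

  ιℤ : ℤ → Carrier
  ιℤ (+ n)      = ι n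
  ιℤ -[1+ n ]   = - ι (suc n)

  infixr 8 _^_
  _^_ : Carrier → ℕ → Carrier
  u ^ zero  = 1#
  u ^ suc n = u * (u ^ n)

  sumTo : ℕ → (ℕ → Carrier) → Carrier
  sumTo zero    f = 0#
  sumTo (suc n) f = sumTo n f + f n

  mat : (x y : Carrier) → (ℕ → Carrier) → ℕ → ℕ → Carrier
  mat x y a0 n zero    = a0 n
  mat x y a0 n (suc m) =
    ((x * ι (suc m)) ⁻¹) * (mat x y a0 (suc n) m - (y * ι m) * mat x y a0 n m)

  FPS : Set c
  FPS = ℕ → Carrier

  _≋_ : FPS → FPS → Set ℓ
  f ≋ g = ∀ k → f k ≈ g k

  _⊛_ : FPS → FPS → FPS
  (f ⊛ g) m = sumTo (suc m) (λ i → f i * g (m ℕ.∸ i))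

  pow : FPS → ℕ → FPS
  pow g zero    = λ { zero → 1# ; (suc _) → 0# }
  pow g (suc k) = g ⊛ pow g k

  -- composition f(g(t)), intended for g with zero constant term,
  -- in which case only k ≤ m contribute to the coefficient of t^m.
  compose : FPS → FPS → FPS
  compose f g m = sumTo (suc m) (λ k → f k * pow g k m)

  lnOnePlus : FPS
  lnOnePlus zero    = 0#
  lnOnePlus (suc j) = ((- 1#) ^ j) * (ι (suc j) ⁻¹)

  scaleArg : Carrier → FPS → FPS
  scaleArg a f j = (a ^ j) * f j

  scale : Carrier → FPS → FPS
  scale a f j = a * f j

  Bhat : (ℕ → Carrier) → ℕ → FPS
  Bhat a0 s k = a0 (k ℕ.+ s) * (ι (k !) ⁻¹)

  Ahat : (x y : Carrier) → (ℕ → Carrier) → ℕ → FPS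
  Ahat x y a0 s m = mat x y a0 s m

  innerSeries : (x y : Carrier) → FPS
  innerSeries x y = scale (y ⁻¹) (scaleArg (y * (x ⁻¹)) lnOnePlus)

-- Put T(n,m) = Σₖ y⁻ᵏ s(m,k) a(n+k,0).  The recurrence s(m+1,k+1) = s(m,k) − m·s(m,k+1) gives
-- T(n,m+1) = y⁻¹ T(n+1,m) − m T(n,m), which after multiplying by y^(m+1) is exactly the recurrence
-- of a(n,m) multiplied by x^(m+1)(m+1)!; so (1) follows by induction on m.
-- In (2) the coefficient of t^m on the right is Σₖ a(s+k,0) y⁻ᵏ (y/x)^m [t^m]L^k / k! with
-- L = ln(1+t), so (2) reduces to (1) through the classical identity m!·[t^m]L^k = k!·s(m,k).
-- That identity is the coefficientwise form of (1+t)·θ(L^(k+1)) = (k+1)·t·L^k, θ = t·d/dt, which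
-- follows from the Leibniz rule for θ and (1+t)·θL = t.  Multiplying by 1+t, rather than dividing,
-- keeps every step an identity between finite Cauchy sums.

module Submission where

open import Defs
open import Data.Nat using (ℕ; suc)
import Data.Nat as ℕ
open import Data.Nat.Base using (_!)
open import Data.Product using (_×_)

open import Data.Nat using (zero)
import Data.Nat.Properties as ℕ
open import Data.Integer as ℤ using (ℤ; +_; -[1+_])
import Data.Integer.Properties as ℤ
open import Data.Sign as Sign using (Sign)
open import Data.Maybe using (Maybe; just; nothing)
open import Data.Product using (_,_)
open import Relation.Nullary using (yes; no)
open import Relation.Binary.Bundles using (Setoid)
open import Function.Indexed.Relation.Binary.Equality using (≡-setoid)
import Relation.Binary.Indexed.Heterogeneous.Construct.Trivial as Trivial
open import Relation.Binary.PropositionalEquality as ≡ using (_≡_)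
import Algebra.Solver.Ring.AlmostCommutativeRing as ACR
import Algebra.Solver.Ring as RingSolver
import Algebra.Properties.Ring as RingProperties
import Algebra.Properties.AbelianGroup as AbelianGroupProperties
import Algebra.Properties.CommutativeSemigroup as CommutativeSemigroupProperties
import Relation.Binary.Reasoning.Setoid as SetoidReasoning

module CanonicalHomomorphism {c ℓ} (F : CharZeroField c ℓ) where
  open CharZeroField F hiding (zero)
  open FieldDefs F
  open RingProperties ring using (-‿involutive; -0#≈0#; -1*x≈-x; -‿distribʳ-*)
  open SetoidReasoning setoid

  ι-+ : ∀ m n → ι (m ℕ.+ n) ≈ ι m + ι n
  ι-+ zero    n = sym (+-identityˡ _)
  ι-+ (suc m) n = trans (+-congˡ (ι-+ m n)) (sym (+-assoc _ _ _))

  ι-* : ∀ m n → ι (m ℕ.* n) ≈ ι m * ι n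
  ι-* zero    n = sym (zeroˡ _)
  ι-* (suc m) n = begin
    ι (n ℕ.+ m ℕ.* n)     ≈⟨ ι-+ n (m ℕ.* n) ⟩
    ι n + ι (m ℕ.* n)     ≈⟨ +-cong (sym (*-identityˡ _)) (ι-* m n) ⟩
    1# * ι n + ι m * ι n  ≈⟨ distribʳ _ _ _ ⟨
    (1# + ι m) * ι n      ∎

  ιℤ-⊖ : ∀ m n → ιℤ (m ℤ.⊖ n) ≈ ι m - ι n
  ιℤ-⊖ m zero = begin
    ιℤ (m ℤ.⊖ 0) ≡⟨ ≡.cong ιℤ (ℤ.⊖-≥ {m} ℕ.z≤n) ⟩
    ι m          ≈⟨ +-identityʳ _ ⟨
    ι m + 0#     ≈⟨ +-congˡ -0#≈0# ⟨
    ι m - 0#     ∎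
  ιℤ-⊖ zero (suc n) = begin
    ιℤ (0 ℤ.⊖ suc n) ≡⟨ ≡.cong ιℤ (ℤ.⊖-< {0} {suc n} (ℕ.s≤s ℕ.z≤n)) ⟩
    - ι (suc n)      ≈⟨ +-identityˡ _ ⟨
    0# - ι (suc n)   ∎
  ιℤ-⊖ (suc m) (suc n) = begin
    ιℤ (suc m ℤ.⊖ suc n)        ≡⟨ ≡.cong ιℤ (ℤ.[1+m]⊖[1+n]≡m⊖n m n) ⟩
    ιℤ (m ℤ.⊖ n)                ≈⟨ ιℤ-⊖ m n ⟩
    ι m - ι n                   ≈⟨ +-identityˡ _ ⟨
    0# + (ι m - ι n)            ≈⟨ +-congʳ (-‿inverseʳ 1#) ⟨
    (1# - 1#) + (ι m - ι n)     ≈⟨ interchange 1# (- 1#) (ι m) (- ι n) ⟩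
    (1# + ι m) + (- 1# - ι n)   ≈⟨ +-congˡ (⁻¹-∙-comm 1# (ι n)) ⟩
    (1# + ι m) - (1# + ι n)     ∎
    where
    open AbelianGroupProperties +-abelianGroup using (⁻¹-∙-comm)
    open CommutativeSemigroupProperties +-commutativeSemigroup using (interchange)

  ιℤ-neg : ∀ z → ιℤ (ℤ.- z) ≈ - ιℤ z
  ιℤ-neg (+ zero)  = sym -0#≈0#
  ιℤ-neg (+ suc n) = refl
  ιℤ-neg -[1+ n ]  = sym (-‿involutive _)

  ιℤ-+ : ∀ a b → ιℤ (a ℤ.+ b) ≈ ιℤ a + ιℤ b
  ιℤ-+ (+ m)    (+ n)    = ι-+ m n
  ιℤ-+ (+ m)    -[1+ n ] = ιℤ-⊖ m (suc n)
  ιℤ-+ -[1+ m ] (+ n)    = trans (ιℤ-⊖ n (suc m)) (+-comm _ _)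
  ιℤ-+ -[1+ m ] -[1+ n ] = begin
    - ι (suc (suc (m ℕ.+ n)))   ≡⟨ ≡.cong (λ k → - ι (suc k)) (ℕ.+-suc m n) ⟨
    - ι (suc m ℕ.+ suc n)       ≈⟨ -‿cong (ι-+ (suc m) (suc n)) ⟩
    - (ι (suc m) + ι (suc n))   ≈⟨ ⁻¹-∙-comm _ _ ⟨
    - ι (suc m) + - ι (suc n)   ∎
    where open AbelianGroupProperties +-abelianGroup using (⁻¹-∙-comm)

  signToRing : Sign → Carrier
  signToRing Sign.+ = 1#
  signToRing Sign.- = - 1#

  signToRing-* : ∀ s t → signToRing (s Sign.* t) ≈ signToRing s * signToRing t
  signToRing-* Sign.+ t      = sym (*-identityˡ _)
  signToRing-* Sign.- Sign.+ = sym (*-identityʳ _)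
  signToRing-* Sign.- Sign.- = begin
    1#             ≈⟨ -‿involutive _ ⟨
    - - 1#         ≈⟨ -‿cong (-1*x≈-x 1#) ⟨
    - (- 1# * 1#)  ≈⟨ -‿distribʳ-* _ _ ⟩
    - 1# * - 1#    ∎

  ιℤ-◃ : ∀ s n → ιℤ (s ℤ.◃ n) ≈ signToRing s * ι n
  ιℤ-◃ s       zero    = sym (zeroʳ _)
  ιℤ-◃ Sign.+ (suc n) = sym (*-identityˡ _)
  ιℤ-◃ Sign.- (suc n) = sym (-1*x≈-x _)

  ιℤ-sign-abs : ∀ z → ιℤ z ≈ signToRing (ℤ.sign z) * ι ℤ.∣ z ∣
  ιℤ-sign-abs z = begin
    ιℤ z                              ≡⟨ ≡.cong ιℤ (ℤ.◃-inverse z) ⟨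
    ιℤ (ℤ.sign z ℤ.◃ ℤ.∣ z ∣)         ≈⟨ ιℤ-◃ (ℤ.sign z) ℤ.∣ z ∣ ⟩
    signToRing (ℤ.sign z) * ι ℤ.∣ z ∣ ∎

  ιℤ-* : ∀ a b → ιℤ (a ℤ.* b) ≈ ιℤ a * ιℤ b
  ιℤ-* a b = begin
    ιℤ (a ℤ.* b)
      ≈⟨ ιℤ-◃ (ℤ.sign a Sign.* ℤ.sign b) (ℤ.∣ a ∣ ℕ.* ℤ.∣ b ∣) ⟩
    signToRing (ℤ.sign a Sign.* ℤ.sign b) * ι (ℤ.∣ a ∣ ℕ.* ℤ.∣ b ∣)
      ≈⟨ *-cong (signToRing-* (ℤ.sign a) (ℤ.sign b)) (ι-* ℤ.∣ a ∣ ℤ.∣ b ∣) ⟩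
    (signToRing (ℤ.sign a) * signToRing (ℤ.sign b)) * (ι ℤ.∣ a ∣ * ι ℤ.∣ b ∣)
      ≈⟨ interchange _ _ _ _ ⟩
    (signToRing (ℤ.sign a) * ι ℤ.∣ a ∣) * (signToRing (ℤ.sign b) * ι ℤ.∣ b ∣)
      ≈⟨ *-cong (ιℤ-sign-abs a) (ιℤ-sign-abs b) ⟨
    ιℤ a * ιℤ b ∎
    where open CommutativeSemigroupProperties *-commutativeSemigroup using (interchange)

  ιℤ-morphism : ℤ.+-*-rawRing ACR.-Raw-AlmostCommutative⟶ ACR.fromCommutativeRing commutativeRing
  ιℤ-morphism = record
    { ⟦_⟧ = ιℤ ; +-homo = ιℤ-+ ; *-homo = ιℤ-* ; -‿homo = ιℤ-neg
    ; 0-homo = refl ; 1-homo = +-identityʳ 1# }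

  ιℤ-≟ : ∀ a b → Maybe (ιℤ a ≈ ιℤ b)
  ιℤ-≟ a b with a ℤ.≟ b
  ... | yes ≡.refl = just refl
  ... | no _       = nothing

  open RingSolver ℤ.+-*-rawRing (ACR.fromCommutativeRing commutativeRing) ιℤ-morphism ιℤ-≟ public
    using (solve; _:=_; _:+_; _:*_; :-_; _:-_; con)

module FieldArithmetic {c ℓ} (F : CharZeroField c ℓ) where
  open CharZeroField F hiding (zero)
  open FieldDefs F
  open CanonicalHomomorphism F
  open SetoidReasoning setoid

  ι-≉0 : ∀ n → .{{_ : ℕ.NonZero n}} → ι n ≉ 0#
  ι-≉0 n ι≈0 = ℕ.≢-nonZero⁻¹ n (charZero n ι≈0)

  ι-!≉0 : ∀ m → ι (m !) ≉ 0#
  ι-!≉0 m = ι-≉0 (m !) {{m ℕ.!≢0}}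

  1≉0 : 1# ≉ 0#
  1≉0 1≈0 = ι-≉0 1 (trans (+-identityʳ 1#) 1≈0)

  x*y≈z⇒y≈x⁻¹*z : ∀ {u v w} → u ≉ 0# → u * v ≈ w → v ≈ u ⁻¹ * w
  x*y≈z⇒y≈x⁻¹*z {u} {v} {w} u≉0 uv≈w = begin
    v                 ≈⟨ *-identityˡ v ⟨
    1# * v            ≈⟨ *-congʳ (inverseʳ u u≉0) ⟨
    (u * u ⁻¹) * v    ≈⟨ solve 3 (λ u u⁻¹ v → (u :* u⁻¹) :* v := u⁻¹ :* (u :* v)) refl u (u ⁻¹) v ⟩
    u ⁻¹ * (u * v)    ≈⟨ *-congˡ uv≈w ⟩
    u ⁻¹ * w          ∎

  *-≉0 : ∀ {u v} → u ≉ 0# → v ≉ 0# → u * v ≉ 0#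
  *-≉0 {u} {v} u≉0 v≉0 uv≈0 = v≉0 (begin
    v               ≈⟨ x*y≈z⇒y≈x⁻¹*z u≉0 uv≈0 ⟩
    u ⁻¹ * 0#       ≈⟨ zeroʳ _ ⟩
    0#              ∎)

  ^-≉0 : ∀ {u} → u ≉ 0# → ∀ m → u ^ m ≉ 0#
  ^-≉0 u≉0 zero    = 1≉0
  ^-≉0 u≉0 (suc m) = *-≉0 u≉0 (^-≉0 u≉0 m)

  ⁻¹-distrib-* : ∀ {u v} → u ≉ 0# → v ≉ 0# → (u * v) ⁻¹ ≈ u ⁻¹ * v ⁻¹
  ⁻¹-distrib-* {u} {v} u≉0 v≉0 = sym (begin
    u ⁻¹ * v ⁻¹                     ≈⟨ x*y≈z⇒y≈x⁻¹*z (*-≉0 u≉0 v≉0) uv*u⁻¹v⁻¹≈1 ⟩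
    (u * v) ⁻¹ * 1#                 ≈⟨ *-identityʳ _ ⟩
    (u * v) ⁻¹                      ∎)
    where
    uv*u⁻¹v⁻¹≈1 : (u * v) * (u ⁻¹ * v ⁻¹) ≈ 1#
    uv*u⁻¹v⁻¹≈1 = begin
      (u * v) * (u ⁻¹ * v ⁻¹)       ≈⟨ solve 4 (λ u v u⁻¹ v⁻¹ → (u :* v) :* (u⁻¹ :* v⁻¹) := (u :* u⁻¹) :* (v :* v⁻¹)) refl u v (u ⁻¹) (v ⁻¹) ⟩
      (u * u ⁻¹) * (v * v ⁻¹)       ≈⟨ *-cong (inverseʳ u u≉0) (inverseʳ v v≉0) ⟩
      1# * 1#                       ≈⟨ *-identityʳ 1# ⟩
      1#                            ∎

  ⁻¹-distrib-^ : ∀ {u} → u ≉ 0# → ∀ m → (u ^ m) ⁻¹ ≈ (u ⁻¹) ^ m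
  ⁻¹-distrib-^ u≉0 zero    = sym (trans (x*y≈z⇒y≈x⁻¹*z 1≉0 (*-identityʳ 1#)) (*-identityʳ _))
  ⁻¹-distrib-^ u≉0 (suc m) = trans (⁻¹-distrib-* u≉0 (^-≉0 u≉0 m)) (*-congˡ (⁻¹-distrib-^ u≉0 m))

  ^-distribˡ-+-* : ∀ u i j → u ^ (i ℕ.+ j) ≈ u ^ i * u ^ j
  ^-distribˡ-+-* u zero    j = sym (*-identityˡ _)
  ^-distribˡ-+-* u (suc i) j = trans (*-congˡ (^-distribˡ-+-* u i j)) (sym (*-assoc _ _ _))

  ^-distribʳ-* : ∀ u v m → (u * v) ^ m ≈ u ^ m * v ^ m
  ^-distribʳ-* u v zero    = sym (*-identityˡ _)
  ^-distribʳ-* u v (suc m) = trans (*-congˡ (^-distribʳ-* u v m))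
    (solve 4 (λ u v p q → (u :* v) :* (p :* q) := (u :* p) :* (v :* q)) refl u v (u ^ m) (v ^ m))

  sumTo-cong : ∀ n {f g : ℕ → Carrier} → (∀ i → i ℕ.< n → f i ≈ g i) → sumTo n f ≈ sumTo n g
  sumTo-cong zero    f≈g = refl
  sumTo-cong (suc n) f≈g = +-cong (sumTo-cong n (λ i i<n → f≈g i (ℕ.m<n⇒m<1+n i<n))) (f≈g n ℕ.≤-refl)

  sumTo-zero : ∀ n {f : ℕ → Carrier} → (∀ i → i ℕ.< n → f i ≈ 0#) → sumTo n f ≈ 0#
  sumTo-zero zero    f≈0 = refl
  sumTo-zero (suc n) f≈0 =
    trans (+-cong (sumTo-zero n (λ i i<n → f≈0 i (ℕ.m<n⇒m<1+n i<n))) (f≈0 n ℕ.≤-refl)) (+-identityʳ 0#)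

  sumTo-+ : ∀ n (f g : ℕ → Carrier) → sumTo n (λ i → f i + g i) ≈ sumTo n f + sumTo n g
  sumTo-+ zero    f g = sym (+-identityʳ 0#)
  sumTo-+ (suc n) f g = trans (+-congʳ (sumTo-+ n f g))
    (solve 4 (λ a b c d → (a :+ b) :+ (c :+ d) := (a :+ c) :+ (b :+ d)) refl _ _ _ _)

  *-distribˡ-sumTo : ∀ n u (f : ℕ → Carrier) → u * sumTo n f ≈ sumTo n (λ i → u * f i)
  *-distribˡ-sumTo zero    u f = zeroʳ u
  *-distribˡ-sumTo (suc n) u f = trans (distribˡ _ _ _) (+-congʳ (*-distribˡ-sumTo n u f))

  sumTo-head-tail : ∀ n (f : ℕ → Carrier) → sumTo (suc n) f ≈ f 0 + sumTo n (λ i → f (suc i))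
  sumTo-head-tail zero    f = +-comm _ _
  sumTo-head-tail (suc n) f = trans (+-congʳ (sumTo-head-tail n f)) (+-assoc _ _ _)

module Series {c ℓ} (F : CharZeroField c ℓ) where
  open CharZeroField F hiding (zero)
  open FieldDefs F
  open CanonicalHomomorphism F
  open FieldArithmetic F

  ≋-setoid : Setoid c ℓ
  ≋-setoid = ≡-setoid ℕ (Trivial.indexedSetoid setoid)

  open Setoid ≋-setoid public using () renaming (refl to ≋-refl; trans to ≋-trans)

  infixl 6 _⊕_
  _⊕_ : FPS → FPS → FPS
  (f ⊕ g) m = f m + g m

  0ₛ : FPS
  0ₛ _ = 0#

  1ₛ : FPS
  1ₛ zero    = 1#
  1ₛ (suc _) = 0#

  infixr 25 t*_ [1+t]*_
  t*_ : FPS → FPS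
  (t* f) zero    = 0#
  (t* f) (suc m) = f m

  [1+t]*_ : FPS → FPS
  [1+t]* f = f ⊕ t* f

  euler : FPS → FPS
  euler f m = ι m * f m

  ⊕-cong : ∀ {f f′ g g′} → f ≋ f′ → g ≋ g′ → (f ⊕ g) ≋ (f′ ⊕ g′)
  ⊕-cong f≋f′ g≋g′ m = +-cong (f≋f′ m) (g≋g′ m)

  t*-cong : ∀ {f g} → f ≋ g → t* f ≋ t* g
  t*-cong f≋g zero    = refl
  t*-cong f≋g (suc m) = f≋g m

  [1+t]*-cong : ∀ {f g} → f ≋ g → [1+t]* f ≋ [1+t]* g
  [1+t]*-cong f≋g = ⊕-cong f≋g (t*-cong f≋g)

  scale-cong : ∀ u {f g} → f ≋ g → scale u f ≋ scale u g
  scale-cong u f≋g m = *-congˡ (f≋g m)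

  ⊛-congˡ : ∀ {f f′} g → f ≋ f′ → (f ⊛ g) ≋ (f′ ⊛ g)
  ⊛-congˡ g f≋f′ m = sumTo-cong (suc m) (λ i _ → *-congʳ (f≋f′ i))

  ⊛-congʳ : ∀ f {g g′} → g ≋ g′ → (f ⊛ g) ≋ (f ⊛ g′)
  ⊛-congʳ f g≋g′ m = sumTo-cong (suc m) (λ i _ → *-congˡ (g≋g′ (m ℕ.∸ i)))

  ⊛-distribˡ-⊕ : ∀ f g h → (f ⊛ (g ⊕ h)) ≋ (f ⊛ g ⊕ f ⊛ h)
  ⊛-distribˡ-⊕ f g h m = trans (sumTo-cong (suc m) (λ i _ → distribˡ _ _ _)) (sumTo-+ (suc m) _ _)

  ⊛-distribʳ-⊕ : ∀ f g h → ((f ⊕ g) ⊛ h) ≋ (f ⊛ h ⊕ g ⊛ h)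
  ⊛-distribʳ-⊕ f g h m = trans (sumTo-cong (suc m) (λ i _ → distribʳ _ _ _)) (sumTo-+ (suc m) _ _)

  ⊛-identityˡ : ∀ g → (1ₛ ⊛ g) ≋ g
  ⊛-identityˡ g m = begin
    (1ₛ ⊛ g) m                                           ≈⟨ sumTo-head-tail m _ ⟩
    1# * g (m ℕ.∸ 0) + sumTo m (λ i → 0# * g (m ℕ.∸ suc i)) ≈⟨ +-cong (*-identityˡ _) (sumTo-zero m (λ i _ → zeroˡ _)) ⟩
    g m + 0#                                             ≈⟨ +-identityʳ _ ⟩
    g m                                                  ∎
    where open SetoidReasoning setoid

  ⊛-zeroʳ : ∀ f → (f ⊛ 0ₛ) ≋ 0ₛ
  ⊛-zeroʳ f m = sumTo-zero (suc m) (λ i _ → zeroʳ _)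

  scale-⊛ˡ : ∀ u f g → (scale u f ⊛ g) ≋ scale u (f ⊛ g)
  scale-⊛ˡ u f g m = trans (sumTo-cong (suc m) (λ i _ → *-assoc _ _ _)) (sym (*-distribˡ-sumTo (suc m) u _))

  scale-⊛ʳ : ∀ u f g → (f ⊛ scale u g) ≋ scale u (f ⊛ g)
  scale-⊛ʳ u f g m = trans
    (sumTo-cong (suc m) (λ i _ → solve 3 (λ u a b → a :* (u :* b) := u :* (a :* b)) refl u _ _))
    (sym (*-distribˡ-sumTo (suc m) u _))

  t*-⊛ˡ : ∀ f g → (t* f ⊛ g) ≋ t* (f ⊛ g)
  t*-⊛ˡ f g zero    = trans (+-identityˡ _) (zeroˡ _)
  t*-⊛ˡ f g (suc m) = trans (sumTo-head-tail (suc m) _) (trans (+-congʳ (zeroˡ _)) (+-identityˡ _))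

  t*-⊛ʳ : ∀ f g → (f ⊛ t* g) ≋ t* (f ⊛ g)
  t*-⊛ʳ f g zero    = trans (+-identityˡ _) (zeroʳ _)
  t*-⊛ʳ f g (suc m) = begin
    sumTo (suc m) (λ i → f i * (t* g) (suc m ℕ.∸ i)) + f (suc m) * (t* g) (m ℕ.∸ m)
      ≈⟨ +-cong (sumTo-cong (suc m) (λ i i<1+m → *-congˡ (t*-∸ i<1+m))) (*-congˡ (t*-∸-self m)) ⟩
    (f ⊛ g) m + f (suc m) * 0#
      ≈⟨ +-congˡ (zeroʳ _) ⟩
    (f ⊛ g) m + 0#
      ≈⟨ +-identityʳ _ ⟩
    (f ⊛ g) m ∎
    where
    open SetoidReasoning setoid
    t*-∸ : ∀ {i} → i ℕ.< suc m → (t* g) (suc m ℕ.∸ i) ≈ g (m ℕ.∸ i)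
    t*-∸ (ℕ.s≤s i≤m) rewrite ℕ.+-∸-assoc 1 i≤m = refl
    t*-∸-self : ∀ n → (t* g) (n ℕ.∸ n) ≈ 0#
    t*-∸-self n rewrite ℕ.n∸n≡0 n = refl

  [1+t]*-0ₛ : [1+t]* 0ₛ ≋ 0ₛ
  [1+t]*-0ₛ zero    = +-identityʳ 0#
  [1+t]*-0ₛ (suc m) = +-identityʳ 0#

  [1+t]*-⊕ : ∀ f g → [1+t]* (f ⊕ g) ≋ ([1+t]* f ⊕ [1+t]* g)
  [1+t]*-⊕ f g zero    = solve 2 (λ a b → (a :+ b) :+ con (+ 0) := (a :+ con (+ 0)) :+ (b :+ con (+ 0))) refl _ _
  [1+t]*-⊕ f g (suc m) = solve 4 (λ a b c d → (a :+ b) :+ (c :+ d) := (a :+ c) :+ (b :+ d)) refl _ _ _ _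

  [1+t]*-⊛ˡ : ∀ f g → ([1+t]* (f ⊛ g)) ≋ ([1+t]* f ⊛ g)
  [1+t]*-⊛ˡ f g = begin
    [1+t]* (f ⊛ g)           ≈⟨ ⊕-cong {f = f ⊛ g} ≋-refl (t*-⊛ˡ f g) ⟨
    f ⊛ g ⊕ t* f ⊛ g         ≈⟨ ⊛-distribʳ-⊕ f (t* f) g ⟨
    [1+t]* f ⊛ g             ∎
    where open SetoidReasoning ≋-setoid

  [1+t]*-⊛ʳ : ∀ f g → ([1+t]* (f ⊛ g)) ≋ (f ⊛ [1+t]* g)
  [1+t]*-⊛ʳ f g = begin
    [1+t]* (f ⊛ g)           ≈⟨ ⊕-cong {f = f ⊛ g} ≋-refl (t*-⊛ʳ f g) ⟨
    f ⊛ g ⊕ f ⊛ t* g         ≈⟨ ⊛-distribˡ-⊕ f g (t* g) ⟨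
    f ⊛ [1+t]* g             ∎
    where open SetoidReasoning ≋-setoid

  ι-∸ : ∀ {i m} → i ℕ.≤ m → ι m ≈ ι i + ι (m ℕ.∸ i)
  ι-∸ {i} {m} i≤m = trans (reflexive (≡.cong ι (≡.sym (ℕ.m+[n∸m]≡n i≤m)))) (ι-+ i (m ℕ.∸ i))

  euler-⊛ : ∀ f g → euler (f ⊛ g) ≋ (euler f ⊛ g ⊕ f ⊛ euler g)
  euler-⊛ f g m = begin
    ι m * (f ⊛ g) m
      ≈⟨ *-distribˡ-sumTo (suc m) (ι m) _ ⟩
    sumTo (suc m) (λ i → ι m * (f i * g (m ℕ.∸ i)))
      ≈⟨ sumTo-cong (suc m) leibniz ⟩
    sumTo (suc m) (λ i → (ι i * f i) * g (m ℕ.∸ i) + f i * (ι (m ℕ.∸ i) * g (m ℕ.∸ i)))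
      ≈⟨ sumTo-+ (suc m) _ _ ⟩
    (euler f ⊛ g ⊕ f ⊛ euler g) m ∎
    where
    open SetoidReasoning setoid
    leibniz : ∀ i → i ℕ.< suc m →
              ι m * (f i * g (m ℕ.∸ i)) ≈ (ι i * f i) * g (m ℕ.∸ i) + f i * (ι (m ℕ.∸ i) * g (m ℕ.∸ i))
    leibniz i (ℕ.s≤s i≤m) = trans (*-congʳ (ι-∸ i≤m))
      (solve 4 (λ a b u v → (a :+ b) :* (u :* v) := (a :* u) :* v :+ u :* (b :* v)) refl _ _ _ _)

  euler-pow-zero : ∀ g → euler (pow g 0) ≋ 0ₛ
  euler-pow-zero g zero    = zeroˡ 1#
  euler-pow-zero g (suc m) = zeroʳ _

  pow-scale : ∀ u f k → pow (scale u f) k ≋ scale (u ^ k) (pow f k)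
  pow-scale u f zero    zero    = sym (*-identityˡ _)
  pow-scale u f zero    (suc m) = sym (*-identityˡ _)
  pow-scale u f (suc k) = begin
    scale u f ⊛ pow (scale u f) k          ≈⟨ ⊛-congʳ (scale u f) (pow-scale u f k) ⟩
    scale u f ⊛ scale (u ^ k) (pow f k)    ≈⟨ scale-⊛ˡ u f (scale (u ^ k) (pow f k)) ⟩
    scale u (f ⊛ scale (u ^ k) (pow f k))  ≈⟨ scale-cong u (scale-⊛ʳ (u ^ k) f (pow f k)) ⟩
    scale u (scale (u ^ k) (f ⊛ pow f k))  ≈⟨ (λ _ → *-assoc _ _ _) ⟨
    scale (u ^ suc k) (pow f (suc k))      ∎
    where open SetoidReasoning ≋-setoid

  scaleArg-⊛ : ∀ u f g → (scaleArg u f ⊛ scaleArg u g) ≋ scaleArg u (f ⊛ g)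
  scaleArg-⊛ u f g m = trans (sumTo-cong (suc m) homogeneous) (sym (*-distribˡ-sumTo (suc m) (u ^ m) _))
    where
    open SetoidReasoning setoid
    homogeneous : ∀ i → i ℕ.< suc m →
                  (u ^ i * f i) * (u ^ (m ℕ.∸ i) * g (m ℕ.∸ i)) ≈ u ^ m * (f i * g (m ℕ.∸ i))
    homogeneous i (ℕ.s≤s i≤m) = begin
      (u ^ i * f i) * (u ^ (m ℕ.∸ i) * g (m ℕ.∸ i))
        ≈⟨ solve 4 (λ p q a b → (p :* a) :* (q :* b) := (p :* q) :* (a :* b)) refl _ _ _ _ ⟩
      (u ^ i * u ^ (m ℕ.∸ i)) * (f i * g (m ℕ.∸ i))
        ≈⟨ *-congʳ (^-distribˡ-+-* u i (m ℕ.∸ i)) ⟨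
      u ^ (i ℕ.+ (m ℕ.∸ i)) * (f i * g (m ℕ.∸ i))
        ≡⟨ ≡.cong (λ n → u ^ n * (f i * g (m ℕ.∸ i))) (ℕ.m+[n∸m]≡n i≤m) ⟩
      u ^ m * (f i * g (m ℕ.∸ i)) ∎

  pow-scaleArg : ∀ u f k → pow (scaleArg u f) k ≋ scaleArg u (pow f k)
  pow-scaleArg u f zero    zero    = sym (*-identityˡ _)
  pow-scaleArg u f zero    (suc m) = sym (zeroʳ _)
  pow-scaleArg u f (suc k) =
    ≋-trans (⊛-congʳ (scaleArg u f) (pow-scaleArg u f k)) (scaleArg-⊛ u f (pow f k))

  module PowerRule (g : FPS) ([1+t]*euler-g≋t : [1+t]* euler g ≋ t* 1ₛ) where
    open SetoidReasoning ≋-setoid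

    mutual
      [1+t]*euler-pow : ∀ k → [1+t]* euler (pow g (suc k)) ≋ scale (ι (suc k)) (t* pow g k)
      [1+t]*euler-pow k = begin
        [1+t]* euler (g ⊛ pow g k)
          ≈⟨ [1+t]*-cong (euler-⊛ g (pow g k)) ⟩
        [1+t]* (euler g ⊛ pow g k ⊕ g ⊛ euler (pow g k))
          ≈⟨ [1+t]*-⊕ (euler g ⊛ pow g k) (g ⊛ euler (pow g k)) ⟩
        [1+t]* (euler g ⊛ pow g k) ⊕ [1+t]* (g ⊛ euler (pow g k))
          ≈⟨ ⊕-cong ([1+t]*-⊛ˡ (euler g) (pow g k)) ([1+t]*g⊛euler-pow k) ⟩
        ([1+t]* euler g) ⊛ pow g k ⊕ scale (ι k) (t* pow g k)
          ≈⟨ ⊕-cong (⊛-congˡ (pow g k) [1+t]*euler-g≋t) ≋-refl ⟩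
        (t* 1ₛ) ⊛ pow g k ⊕ scale (ι k) (t* pow g k)
          ≈⟨ ⊕-cong (≋-trans (t*-⊛ˡ 1ₛ (pow g k)) (t*-cong (⊛-identityˡ (pow g k)))) ≋-refl ⟩
        t* pow g k ⊕ scale (ι k) (t* pow g k)
          ≈⟨ (λ m → trans (distribʳ _ _ _) (+-congʳ (*-identityˡ _))) ⟨
        scale (ι (suc k)) (t* pow g k) ∎

      [1+t]*g⊛euler-pow : ∀ k → [1+t]* (g ⊛ euler (pow g k)) ≋ scale (ι k) (t* pow g k)
      [1+t]*g⊛euler-pow zero = begin
        [1+t]* (g ⊛ euler (pow g 0))   ≈⟨ [1+t]*-cong (≋-trans (⊛-congʳ g (euler-pow-zero g)) (⊛-zeroʳ g)) ⟩
        [1+t]* 0ₛ                      ≈⟨ [1+t]*-0ₛ ⟩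
        0ₛ                             ≈⟨ (λ _ → zeroˡ _) ⟨
        scale 0# (t* pow g 0)          ∎
      [1+t]*g⊛euler-pow (suc k) = begin
        [1+t]* (g ⊛ euler (pow g (suc k)))        ≈⟨ [1+t]*-⊛ʳ g (euler (pow g (suc k))) ⟩
        g ⊛ [1+t]* euler (pow g (suc k))          ≈⟨ ⊛-congʳ g ([1+t]*euler-pow k) ⟩
        g ⊛ scale (ι (suc k)) (t* pow g k)        ≈⟨ scale-⊛ʳ (ι (suc k)) g (t* pow g k) ⟩
        scale (ι (suc k)) (g ⊛ t* pow g k)        ≈⟨ scale-cong (ι (suc k)) (t*-⊛ʳ g (pow g k)) ⟩
        scale (ι (suc k)) (t* pow g (suc k))      ∎

module Stirling {c ℓ} (F : CharZeroField c ℓ) where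
  open CharZeroField F hiding (zero)
  open FieldDefs F
  open CanonicalHomomorphism F
  open FieldArithmetic F
  open Series F
  open RingProperties ring using (-0#≈0#; -1*x≈-x)
  open SetoidReasoning setoid

  stirling : ℕ → ℕ → Carrier
  stirling m k = ιℤ (stirling1 m k)

  stirling-rec₀ : ∀ m → stirling (suc m) 0 ≈ - (ι m * stirling m 0)
  stirling-rec₀ m = trans (ιℤ-neg (+ m ℤ.* stirling1 m 0)) (-‿cong (ιℤ-* (+ m) (stirling1 m 0)))

  stirling-rec : ∀ m k → stirling (suc m) (suc k) ≈ stirling m k - ι m * stirling m (suc k)
  stirling-rec m k = begin
    ιℤ (stirling1 m k ℤ.- + m ℤ.* stirling1 m (suc k))
      ≈⟨ ιℤ-+ (stirling1 m k) (ℤ.- (+ m ℤ.* stirling1 m (suc k))) ⟩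
    stirling m k + ιℤ (ℤ.- (+ m ℤ.* stirling1 m (suc k)))
      ≈⟨ +-congˡ (ιℤ-neg (+ m ℤ.* stirling1 m (suc k))) ⟩
    stirling m k - ιℤ (+ m ℤ.* stirling1 m (suc k))
      ≈⟨ +-congˡ (-‿cong (ιℤ-* (+ m) (stirling1 m (suc k)))) ⟩
    stirling m k - ι m * stirling m (suc k) ∎

  stirling-suc-zero : ∀ m → stirling (suc m) 0 ≈ 0#
  stirling-suc-zero zero    = trans (stirling-rec₀ 0) (trans (-‿cong (zeroˡ _)) -0#≈0#)
  stirling-suc-zero (suc m) =
    trans (stirling-rec₀ (suc m)) (trans (-‿cong (trans (*-congˡ (stirling-suc-zero m)) (zeroʳ _))) -0#≈0#)

  stirling-above-diagonal : ∀ m j → stirling m (suc (m ℕ.+ j)) ≈ 0#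
  stirling-above-diagonal zero    j = refl
  stirling-above-diagonal (suc m) j = begin
    stirling (suc m) (suc (suc (m ℕ.+ j)))
      ≈⟨ stirling-rec m (suc (m ℕ.+ j)) ⟩
    stirling m (suc (m ℕ.+ j)) - ι m * stirling m (suc (suc (m ℕ.+ j)))
      ≡⟨ ≡.cong (λ n → stirling m (suc (m ℕ.+ j)) - ι m * stirling m (suc n)) (ℕ.+-suc m j) ⟨
    stirling m (suc (m ℕ.+ j)) - ι m * stirling m (suc (m ℕ.+ suc j))
      ≈⟨ +-cong (stirling-above-diagonal m j) (-‿cong (*-congˡ (stirling-above-diagonal m (suc j)))) ⟩
    0# - ι m * 0#
      ≈⟨ solve 1 (λ a → con (+ 0) :- a :* con (+ 0) := con (+ 0)) refl (ι m) ⟩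
    0# ∎

  euler-ln-suc : ∀ j → euler lnOnePlus (suc j) ≈ (- 1#) ^ j
  euler-ln-suc j = begin
    ι (suc j) * ((- 1#) ^ j * ι (suc j) ⁻¹)
      ≈⟨ solve 3 (λ a p b → a :* (p :* b) := p :* (a :* b)) refl _ _ _ ⟩
    (- 1#) ^ j * (ι (suc j) * ι (suc j) ⁻¹)
      ≈⟨ *-congˡ (inverseʳ _ (ι-≉0 (suc j))) ⟩
    (- 1#) ^ j * 1#
      ≈⟨ *-identityʳ _ ⟩
    (- 1#) ^ j ∎

  [1+t]*euler-ln : [1+t]* euler lnOnePlus ≋ t* 1ₛ
  [1+t]*euler-ln zero                = trans (+-identityʳ _) (zeroˡ _)
  [1+t]*euler-ln (suc zero)          = trans (+-cong (euler-ln-suc 0) (zeroˡ _)) (+-identityʳ _)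
  [1+t]*euler-ln (suc (suc j)) = begin
    euler lnOnePlus (suc (suc j)) + euler lnOnePlus (suc j) ≈⟨ +-cong (euler-ln-suc (suc j)) (euler-ln-suc j) ⟩
    - 1# * (- 1#) ^ j + (- 1#) ^ j                          ≈⟨ +-congʳ (-1*x≈-x _) ⟩
    - ((- 1#) ^ j) + (- 1#) ^ j                             ≈⟨ -‿inverseˡ _ ⟩
    0#                                                      ∎

  open PowerRule lnOnePlus [1+t]*euler-ln

  ln-pow-rec : ∀ k m → ι (suc m) * pow lnOnePlus (suc k) (suc m)
                       ≈ ι (suc k) * pow lnOnePlus k m - ι m * pow lnOnePlus (suc k) m
  ln-pow-rec k m = begin
    a                ≈⟨ solve 2 (λ a b → a := (a :+ b) :- b) refl a b ⟩
    (a + b) - b      ≈⟨ +-congʳ ([1+t]*euler-pow k (suc m)) ⟩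
    ι (suc k) * pow lnOnePlus k m - b ∎
    where
    a b : Carrier
    a = ι (suc m) * pow lnOnePlus (suc k) (suc m)
    b = ι m * pow lnOnePlus (suc k) m

  ln-pow-coeff : ∀ k m → ι (m !) * pow lnOnePlus k m ≈ ι (k !) * stirling m k
  ln-pow-coeff zero    zero    = *-congˡ (sym (+-identityʳ 1#))
  ln-pow-coeff zero    (suc m) = trans (zeroʳ _) (sym (trans (*-congˡ (stirling-suc-zero m)) (zeroʳ _)))
  ln-pow-coeff (suc k) zero    = trans (*-congˡ (trans (+-identityˡ _) (zeroˡ _))) (trans (zeroʳ _) (sym (zeroʳ _)))
  ln-pow-coeff (suc k) (suc m) = begin
    ι (suc m ℕ.* m !) * L (suc k) (suc m)
      ≈⟨ *-congʳ (ι-* (suc m) (m !)) ⟩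
    (ι (suc m) * ι (m !)) * L (suc k) (suc m)
      ≈⟨ solve 3 (λ a b x → (a :* b) :* x := b :* (a :* x)) refl _ _ _ ⟩
    ι (m !) * (ι (suc m) * L (suc k) (suc m))
      ≈⟨ *-congˡ (ln-pow-rec k m) ⟩
    ι (m !) * (ι (suc k) * L k m - ι m * L (suc k) m)
      ≈⟨ solve 5 (λ f a p b q → f :* (a :* p :- b :* q) := a :* (f :* p) :- b :* (f :* q)) refl _ _ _ _ _ ⟩
    ι (suc k) * (ι (m !) * L k m) - ι m * (ι (m !) * L (suc k) m)
      ≈⟨ +-cong (*-congˡ (ln-pow-coeff k m)) (-‿cong (*-congˡ (ln-pow-coeff (suc k) m))) ⟩
    ι (suc k) * (ι (k !) * stirling m k) - ι m * (ι (suc k ℕ.* k !) * stirling m (suc k))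
      ≈⟨ +-congˡ (-‿cong (*-congˡ (*-congʳ (ι-* (suc k) (k !))))) ⟩
    ι (suc k) * (ι (k !) * stirling m k) - ι m * ((ι (suc k) * ι (k !)) * stirling m (suc k))
      ≈⟨ solve 5 (λ a b s d t → a :* (b :* s) :- d :* ((a :* b) :* t) := (a :* b) :* (s :- d :* t)) refl _ _ _ _ _ ⟩
    (ι (suc k) * ι (k !)) * (stirling m k - ι m * stirling m (suc k))
      ≈⟨ *-cong (ι-* (suc k) (k !)) (stirling-rec m k) ⟨
    ι (suc k ℕ.* k !) * stirling (suc m) (suc k) ∎
    where
    L : ℕ → FPS
    L = pow lnOnePlus

module ClosedForm {c ℓ} (F : CharZeroField c ℓ) where
  open CharZeroField F hiding (zero)
  open FieldDefs F
  open CanonicalHomomorphism F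
  open FieldArithmetic F
  open Stirling F
  open SetoidReasoning setoid

  stirlingTransform : Carrier → (ℕ → Carrier) → ℕ → ℕ → Carrier
  stirlingTransform u a0 n m = sumTo (suc m) (λ k → u ^ k * (stirling m k * a0 (n ℕ.+ k)))

  stirlingTransform-suc : ∀ u a0 n m →
    stirlingTransform u a0 n (suc m)
      ≈ u * stirlingTransform u a0 (suc n) m - ι m * stirlingTransform u a0 n m
  stirlingTransform-suc u a0 n m = begin
    T n (suc m)
      ≈⟨ sumTo-head-tail (suc m) _ ⟩
    1# * (stirling (suc m) 0 * a0 (n ℕ.+ 0))
      + sumTo (suc m) (λ k → u ^ suc k * (stirling (suc m) (suc k) * a0 (n ℕ.+ suc k)))
      ≈⟨ +-cong head (trans (sumTo-cong (suc m) (λ k _ → term k)) (sumTo-+ (suc m) _ _)) ⟩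
    - (ι m * g 0) + (sumTo (suc m) (λ k → u * g′ k) + sumTo (suc m) (λ k → - ι m * g (suc k)))
      ≈⟨ +-congˡ (+-cong (*-distribˡ-sumTo (suc m) u g′) (*-distribˡ-sumTo (suc m) (- ι m) _)) ⟨
    - (ι m * g 0) + (u * T (suc n) m + - ι m * sumTo (suc m) (λ k → g (suc k)))
      ≈⟨ +-congˡ (+-congˡ (*-congˡ shifted)) ⟩
    - (ι m * g 0) + (u * T (suc n) m + - ι m * (T n m - g 0))
      ≈⟨ solve 4 (λ i g₀ t′ t → :- (i :* g₀) :+ (t′ :+ (:- i) :* (t :- g₀)) := t′ :- i :* t) refl _ _ _ _ ⟩
    u * T (suc n) m - ι m * T n m ∎
    where
    T : ℕ → ℕ → Carrier
    T = stirlingTransform u a0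
    g : ℕ → Carrier
    g k = u ^ k * (stirling m k * a0 (n ℕ.+ k))
    g′ : ℕ → Carrier
    g′ k = u ^ k * (stirling m k * a0 (suc n ℕ.+ k))

    head : 1# * (stirling (suc m) 0 * a0 (n ℕ.+ 0)) ≈ - (ι m * g 0)
    head = begin
      1# * (stirling (suc m) 0 * a0 (n ℕ.+ 0))      ≈⟨ *-identityˡ _ ⟩
      stirling (suc m) 0 * a0 (n ℕ.+ 0)             ≈⟨ *-congʳ (stirling-rec₀ m) ⟩
      - (ι m * stirling m 0) * a0 (n ℕ.+ 0)         ≈⟨ solve 3 (λ i s a → :- (i :* s) :* a := :- (i :* (s :* a))) refl _ _ _ ⟩
      - (ι m * (stirling m 0 * a0 (n ℕ.+ 0)))       ≈⟨ -‿cong (*-congˡ (*-identityˡ _)) ⟨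
      - (ι m * g 0)                                 ∎

    term : ∀ k → u ^ suc k * (stirling (suc m) (suc k) * a0 (n ℕ.+ suc k)) ≈ u * g′ k + - ι m * g (suc k)
    term k = begin
      u ^ suc k * (stirling (suc m) (suc k) * a0 (n ℕ.+ suc k))
        ≈⟨ *-congˡ (*-congʳ (stirling-rec m k)) ⟩
      (u * u ^ k) * ((stirling m k - ι m * stirling m (suc k)) * a0 (n ℕ.+ suc k))
        ≡⟨ ≡.cong (λ b → (u * u ^ k) * ((stirling m k - ι m * stirling m (suc k)) * b)) (≡.cong a0 (ℕ.+-suc n k)) ⟩
      (u * u ^ k) * ((stirling m k - ι m * stirling m (suc k)) * a0 (suc n ℕ.+ k))
        ≈⟨ solve 6 (λ u p s i t a → (u :* p) :* ((s :- i :* t) :* a) := u :* (p :* (s :* a)) :+ (:- i) :* ((u :* p) :* (t :* a))) refl _ _ _ _ _ _ ⟩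
      u * g′ k + - ι m * ((u * u ^ k) * (stirling m (suc k) * a0 (suc n ℕ.+ k)))
        ≡⟨ ≡.cong (λ b → u * g′ k + - ι m * ((u * u ^ k) * (stirling m (suc k) * b))) (≡.cong a0 (ℕ.+-suc n k)) ⟨
      u * g′ k + - ι m * g (suc k) ∎

    shifted : sumTo (suc m) (λ k → g (suc k)) ≈ T n m - g 0
    shifted = begin
      sumTo (suc m) (λ k → g (suc k))                   ≈⟨ solve 2 (λ a b → a := (b :+ a) :- b) refl _ _ ⟩
      (g 0 + sumTo (suc m) (λ k → g (suc k))) - g 0     ≈⟨ +-congʳ (sumTo-head-tail (suc m) g) ⟨
      (T n m + g (suc m)) - g 0                         ≈⟨ +-congʳ (+-congˡ top-vanishes) ⟩
      (T n m + 0#) - g 0                                ≈⟨ +-congʳ (+-identityʳ _) ⟩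
      T n m - g 0                                       ∎
      where
      top-vanishes : g (suc m) ≈ 0#
      top-vanishes = begin
        u ^ suc m * (stirling m (suc m) * a0 (n ℕ.+ suc m))
          ≡⟨ ≡.cong (λ j → u ^ suc m * (stirling m (suc j) * a0 (n ℕ.+ suc m))) (ℕ.+-identityʳ m) ⟨
        u ^ suc m * (stirling m (suc (m ℕ.+ 0)) * a0 (n ℕ.+ suc m))
          ≈⟨ *-congˡ (*-congʳ (stirling-above-diagonal m 0)) ⟩
        u ^ suc m * (0# * a0 (n ℕ.+ suc m))
          ≈⟨ trans (*-congˡ (zeroˡ _)) (zeroʳ _) ⟩
        0# ∎

  normaliser : Carrier → ℕ → Carrier
  normaliser x m = x ^ m * ι (m !)

  module _ (x y : Carrier) (x≉0 : x ≉ 0#) (y≉0 : y ≉ 0#) (a0 : ℕ → Carrier) where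

    normaliser-*-mat : ∀ n m → normaliser x m * mat x y a0 n m ≈ y ^ m * stirlingTransform (y ⁻¹) a0 n m
    normaliser-*-mat n zero = begin
      (1# * ι 1) * a0 n                       ≈⟨ *-congʳ (*-identityˡ _) ⟩
      ι 1 * a0 n                              ≡⟨ ≡.cong (λ j → ι 1 * a0 j) (ℕ.+-identityʳ n) ⟨
      ι 1 * a0 (n ℕ.+ 0)                      ≈⟨ *-identityˡ _ ⟨
      1# * (ι 1 * a0 (n ℕ.+ 0))               ≈⟨ +-identityˡ _ ⟨
      0# + 1# * (ι 1 * a0 (n ℕ.+ 0))          ≈⟨ *-identityˡ _ ⟨
      1# * stirlingTransform (y ⁻¹) a0 n 0    ∎
    normaliser-*-mat n (suc m) = begin
      ((x * x ^ m) * ι (suc m ℕ.* m !)) * (V ⁻¹ * (A - (y * ι m) * B))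
        ≈⟨ *-congʳ (*-congˡ (ι-* (suc m) (m !))) ⟩
      ((x * x ^ m) * (ι (suc m) * ι (m !))) * (V ⁻¹ * (A - (y * ι m) * B))
        ≈⟨ solve 9 (λ x xᵐ s f v A y i B → ((x :* xᵐ) :* (s :* f)) :* (v :* (A :- (y :* i) :* B))
                                          := ((x :* s) :* v) :* ((xᵐ :* f) :* A :- (y :* i) :* ((xᵐ :* f) :* B)))
                   refl _ _ _ _ _ _ _ _ _ ⟩
      (V * V ⁻¹) * (normaliser x m * A - (y * ι m) * (normaliser x m * B))
        ≈⟨ *-cong (inverseʳ V (*-≉0 x≉0 (ι-≉0 (suc m))))
                  (+-cong (normaliser-*-mat (suc n) m) (-‿cong (*-congˡ (normaliser-*-mat n m)))) ⟩
      1# * (y ^ m * T (suc n) m - (y * ι m) * (y ^ m * T n m))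
        ≈⟨ *-congʳ (inverseʳ y y≉0) ⟨
      (y * y ⁻¹) * (y ^ m * T (suc n) m - (y * ι m) * (y ^ m * T n m))
        ≈⟨ solve 6 (λ y y⁻¹ yᵐ t′ i t → (y :* y⁻¹) :* (yᵐ :* t′ :- (y :* i) :* (yᵐ :* t))
                                       := (y :* yᵐ) :* (y⁻¹ :* t′ :- (y :* y⁻¹) :* (i :* t)))
                 refl _ _ _ _ _ _ ⟩
      (y * y ^ m) * (y ⁻¹ * T (suc n) m - (y * y ⁻¹) * (ι m * T n m))
        ≈⟨ *-congˡ (+-congˡ (-‿cong (trans (*-congʳ (inverseʳ y y≉0)) (*-identityˡ _)))) ⟩
      (y * y ^ m) * (y ⁻¹ * T (suc n) m - ι m * T n m)
        ≈⟨ *-congˡ (stirlingTransform-suc (y ⁻¹) a0 n m) ⟨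
      (y * y ^ m) * T n (suc m) ∎
      where
      T : ℕ → ℕ → Carrier
      T = stirlingTransform (y ⁻¹) a0
      V A B : Carrier
      V = x * ι (suc m)
      A = mat x y a0 (suc n) m
      B = mat x y a0 n m

    mat-closed-form : ∀ n m → mat x y a0 n m ≈ (y ^ m * normaliser x m ⁻¹) * stirlingTransform (y ⁻¹) a0 n m
    mat-closed-form n m = trans
      (x*y≈z⇒y≈x⁻¹*z (*-≉0 (^-≉0 x≉0 m) (ι-!≉0 m)) (normaliser-*-mat n m))
      (solve 3 (λ w⁻¹ yᵐ t → w⁻¹ :* (yᵐ :* t) := (yᵐ :* w⁻¹) :* t) refl _ _ _)

module Composition {c ℓ} (F : CharZeroField c ℓ) where
  open CharZeroField F hiding (zero)
  open FieldDefs F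
  open CanonicalHomomorphism F
  open FieldArithmetic F
  open Series F
  open Stirling F
  open ClosedForm F
  open SetoidReasoning setoid

  module _ (x y : Carrier) (x≉0 : x ≉ 0#) (y≉0 : y ≉ 0#) (a0 : ℕ → Carrier) where

    innerSeries-pow : ∀ k m → pow (innerSeries x y) k m ≈ (y ⁻¹) ^ k * ((y * x ⁻¹) ^ m * pow lnOnePlus k m)
    innerSeries-pow k m = trans (pow-scale (y ⁻¹) (scaleArg (y * x ⁻¹) lnOnePlus) k m)
                                (*-congˡ (pow-scaleArg (y * x ⁻¹) lnOnePlus k m))

    [y/x]^m/m! : ∀ m → (y * x ⁻¹) ^ m * ι (m !) ⁻¹ ≈ y ^ m * normaliser x m ⁻¹
    [y/x]^m/m! m = begin
      (y * x ⁻¹) ^ m * ι (m !) ⁻¹             ≈⟨ *-congʳ (^-distribʳ-* y (x ⁻¹) m) ⟩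
      (y ^ m * (x ⁻¹) ^ m) * ι (m !) ⁻¹       ≈⟨ *-congʳ (*-congˡ (⁻¹-distrib-^ x≉0 m)) ⟨
      (y ^ m * (x ^ m) ⁻¹) * ι (m !) ⁻¹       ≈⟨ *-assoc _ _ _ ⟩
      y ^ m * ((x ^ m) ⁻¹ * ι (m !) ⁻¹)       ≈⟨ *-congˡ (⁻¹-distrib-* (^-≉0 x≉0 m) (ι-!≉0 m)) ⟨
      y ^ m * normaliser x m ⁻¹               ∎

    compose-term : ∀ s m k → Bhat a0 s k * pow (innerSeries x y) k m
                             ≈ (y ^ m * normaliser x m ⁻¹) * ((y ⁻¹) ^ k * (stirling m k * a0 (s ℕ.+ k)))
    compose-term s m k = begin
      (a0 (k ℕ.+ s) * k!⁻¹) * pow (innerSeries x y) k m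
        ≈⟨ *-congˡ (trans (innerSeries-pow k m) (*-congˡ (*-congˡ ln-pow))) ⟩
      (a0 (k ℕ.+ s) * k!⁻¹) * ((y ⁻¹) ^ k * ((y * x ⁻¹) ^ m * (m!⁻¹ * (ι (k !) * stirling m k))))
        ≈⟨ solve 7 (λ a k!⁻¹ yᵏ cᵐ m!⁻¹ k! s → (a :* k!⁻¹) :* (yᵏ :* (cᵐ :* (m!⁻¹ :* (k! :* s))))
                                           := (k! :* k!⁻¹) :* ((cᵐ :* m!⁻¹) :* (yᵏ :* (s :* a))))
                 refl _ _ _ _ _ _ _ ⟩
      (ι (k !) * k!⁻¹) * (((y * x ⁻¹) ^ m * m!⁻¹) * ((y ⁻¹) ^ k * (stirling m k * a0 (k ℕ.+ s))))
        ≈⟨ *-cong (inverseʳ _ (ι-!≉0 k)) (*-cong ([y/x]^m/m! m) (*-congˡ (*-congˡ (reflexive (≡.cong a0 (ℕ.+-comm k s)))))) ⟩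
      1# * ((y ^ m * normaliser x m ⁻¹) * ((y ⁻¹) ^ k * (stirling m k * a0 (s ℕ.+ k))))
        ≈⟨ *-identityˡ _ ⟩
      (y ^ m * normaliser x m ⁻¹) * ((y ⁻¹) ^ k * (stirling m k * a0 (s ℕ.+ k))) ∎
      where
      k!⁻¹ m!⁻¹ : Carrier
      k!⁻¹ = ι (k !) ⁻¹
      m!⁻¹ = ι (m !) ⁻¹
      ln-pow : pow lnOnePlus k m ≈ m!⁻¹ * (ι (k !) * stirling m k)
      ln-pow = x*y≈z⇒y≈x⁻¹*z (ι-!≉0 m) (ln-pow-coeff k m)

    Ahat≋compose : ∀ s → Ahat x y a0 s ≋ compose (Bhat a0 s) (innerSeries x y)
    Ahat≋compose s m = begin
      mat x y a0 s m
        ≈⟨ mat-closed-form x y x≉0 y≉0 a0 s m ⟩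
      (y ^ m * normaliser x m ⁻¹) * stirlingTransform (y ⁻¹) a0 s m
        ≈⟨ *-distribˡ-sumTo (suc m) (y ^ m * normaliser x m ⁻¹) _ ⟩
      sumTo (suc m) (λ k → (y ^ m * normaliser x m ⁻¹) * ((y ⁻¹) ^ k * (stirling m k * a0 (s ℕ.+ k))))
        ≈⟨ sumTo-cong (suc m) (λ k _ → compose-term s m k) ⟨
      compose (Bhat a0 s) (innerSeries x y) m ∎

mainTheorem2 : ∀ {c ℓ} (F : CharZeroField c ℓ) →
    let open CharZeroField F
        open FieldDefs F
    in (x y : Carrier) → x ≉ 0# → y ≉ 0# → (a0 : ℕ → Carrier) →
       ((n m : ℕ) → mat x y a0 n m ≈
          ((y ^ m) * ((x ^ m) * ι (m !)) ⁻¹)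
            * sumTo (suc m) (λ k → ((y ⁻¹) ^ k) * (ιℤ (stirling1 m k) * a0 (n ℕ.+ k))))
       × ((s : ℕ) → Ahat x y a0 s ≋ compose (Bhat a0 s) (innerSeries x y))
mainTheorem2 F x y x≉0 y≉0 a0 =
  ClosedForm.mat-closed-form F x y x≉0 y≉0 a0 , Composition.Ahat≋compose F x y x≉0 y≉0 a0
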